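{- Let $\mathbbm{k}$ be a field and $\Psi=(\Delta,\Gamma)$ a relative simplicial complex. Then for every $i$, $H^i(P^\ast(\Psi))\cong H^i(\Psi;\mathbbm{k})$.
   Context: Relative complex $\Psi=(\Delta,\Gamma)$: $\Gamma\subseteq\Delta$ simplicial complexes, faces $\Delta\setminus\Gamma$. $\mathrm{st}_\tau\Delta=\{\rho\in\Delta:\rho\cup\tau\in\Delta\}$, $\mathrm{st}_\tau\Psi=(\mathrm{st}_\tau\Delta,\mathrm{st}_\tau\Gamma)$. Face ring $\mathbbm{k}[\Delta]$ = polynomial ring in variables $x_v$ ($v$ vertices of $\Delta$) modulo the ideal of monomials supported on non-faces of $\Delta$; the relative face module is $\mathbbm{k}[\Psi]=I_\Gamma/I_\Delta$, where $I_\Gamma$ is generated by monomials whose support is not a face of $\Gamma$. The partition complex $P^\ast(\Psi)$ has $P^{ -1}=\mathbbm{k}[\Psi]$ and $P^i=\bigoplus_{\tau\in\Delta,\dim\tau=i}\mathbbm{k}[\mathrm{st}_\tau\Psi]$ for $i\ge0$; fixing an order of the vertices, for $\rho\subset\tau=\rho\cup\{v_{i_j}\}$ with $\tau=\{v_{i_1}<\cdots<v_{i_k}\}$ the differential sends $\alpha e_\rho$ to $(-1)^j$ times the restriction of $\alpha$ in the summand $e_\tau$ (summed over all such $\tau$), and $P^{ -1}\to P^0$ is $\alpha\mapsto\sum_v\alpha e_v$. $H^\ast(\Psi;\mathbbm{k})$ denotes the simplicial cohomology of the pair $(\Delta,\Gamma)$ in which the empty set is counted as a face of dimension $-1$ (so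 it is reduced cohomology when $\Gamma=\emptyset$). -}

module Defs where

open import Level using (Level; _⊔_; suc)
open import Data.Bool using (Bool; true; false; if_then_else_; _∧_; not)
open import Data.Nat as ℕ using (ℕ; zero)
open import Data.Integer as ℤ using (ℤ; +_)
open import Data.Fin using (Fin; toℕ) renaming (zero to fz; suc to fs)
open import Data.Vec using (Vec; []; _∷_; map; zipWith; lookup; _[_]≔_)
open import Data.Fin.Subset using (Subset; ∣_∣; _⊆_; _∪_; ⊥; _∈_)
open import Data.Product using (Σ; _×_; _,_; ∃)
open import Relation.Binary.PropositionalEquality using (_≡_)
open import Relation.Nullary using (¬_)
open import Algebra.Bundles using (CommutativeRing)

record Field (c ℓ : Level) : Set (suc (c ⊔ ℓ)) where
  field
    commutativeRing : CommutativeRing c ℓ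
  open CommutativeRing commutativeRing public
  field
    0≉1     : ¬ (0# ≈ 1#)
    inverse : ∀ x → ¬ (x ≈ 0#) → Σ Carrier (λ y → (x * y) ≈ 1#)

-- Simplicial complexes on the vertex set Fin n (vertices ordered by the
-- order of Fin n).  The void complex (no faces at all) is allowed.

record SimplicialComplex (n : ℕ) : Set where
  field
    face      : Subset n → Bool
    downClosed : ∀ {σ τ} → σ ⊆ τ → face τ ≡ true → face σ ≡ true
open SimplicialComplex public

record RelativeComplex (n : ℕ) : Set where
  field
    Δ   : SimplicialComplex n
    Γ   : SimplicialComplex n
    Γ⊆Δ : ∀ τ → face Γ τ ≡ true → face Δ τ ≡ true
open RelativeComplex public

relFace : ∀ {n} → RelativeComplex n → Subset n → Bool
relFace Ψ τ = face (Δ Ψ) τ ∧ not (face (Γ Ψ) τ)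

Monomial : ℕ → Set
Monomial n = Vec ℕ n

nonzeroᵇ : ℕ → Bool
nonzeroᵇ zero    = false
nonzeroᵇ (ℕ.suc _) = true

supp : ∀ {n} → Monomial n → Subset n
supp = map nonzeroᵇ

-- m is a basis monomial of k[st_τ Ψ] (= I_{st_τ Γ}/I_{st_τ Δ}):
-- supp m ∪ τ ∈ Δ and supp m ∪ τ ∉ Γ, i.e. supp m ∈ st_τΔ \ st_τΓ
inStar : ∀ {n} → RelativeComplex n → Subset n → Monomial n → Bool
inStar Ψ τ m = relFace Ψ (supp m ∪ τ)

memᵇ : ∀ {n} → Fin n → Subset n → Bool
memᵇ v τ = lookup τ v

remove : ∀ {n} → Subset n → Fin n → Subset n
remove τ v = τ [ v ]≔ false


module OverField {c ℓ} (K : Field c ℓ) where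
  open Field K

  sumFin : ∀ {n} → (Fin n → Carrier) → Carrier
  sumFin {zero}    f = 0#
  sumFin {ℕ.suc n} f = f fz + sumFin (λ i → f (fs i))

  signPow : ℕ → Carrier
  signPow zero      = 1#
  signPow (ℕ.suc k) = - signPow k

  -- position j (1-indexed) of v in τ = 1 + #{u ∈ τ : u < v}
  position : ∀ {n} → Fin n → Subset n → ℕ
  position {n} v τ = ℕ.suc (count (λ u → lookup τ u ∧ (toℕ u ℕ.<ᵇ toℕ v)))
    where
    count : ∀ {k} → (Fin k → Bool) → ℕ
    count {zero}    p = 0
    count {ℕ.suc k} p = (if p fz then 1 else 0) ℕ.+ count (λ i → p (fs i))

  [_] : Bool → Carrier → Carrier
  [ b ] x = if b then x else 0#

  -- A concrete cochain complex of k-vector spaces: a carrier with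
  -- pointwise vector-space operations, a differential d, and a predicate
  -- Deg i x saying "x lies in the degree-i component".

  record Complex : Set (suc (c ⊔ ℓ)) where
    field
      X    : Set c
      _≐_  : X → X → Set ℓ
      𝟎    : X
      _⊕_  : X → X → X
      _⊖_  : X → X → X
      _⊛_  : Carrier → X → X
      d    : X → X
      Deg  : ℤ → X → Set ℓ

    Cocycle : ℤ → X → Set ℓ
    Cocycle i x = Deg i x × (d x ≐ 𝟎)

    CohomEq : ℤ → X → X → Set (c ⊔ ℓ)
    CohomEq i x y = Σ X (λ h → Deg (i ℤ.- ℤ.1ℤ) h × ((x ⊖ y) ≐ d h))

  -- a k-linear isomorphism H^i(A) ≅ H^i(B), given on cocycle representatives
  record CohomIso (i : ℤ) (A B : Complex) : Set (c ⊔ ℓ) where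
    module A = Complex A
    module B = Complex B
    field
      Φ          : (x : A.X) → A.Cocycle i x → B.X
      Φ-cocycle  : ∀ x p → B.Cocycle i (Φ x p)
      Φ-wd       : ∀ x p y q → A.CohomEq i x y → B.CohomEq i (Φ x p) (Φ y q)
      Φ-linear   : ∀ a x p y q (r : A.Cocycle i ((a A.⊛ x) A.⊕ y)) →
                   B.CohomEq i (Φ _ r) ((a B.⊛ Φ x p) B.⊕ Φ y q)
      Φ-injective : ∀ x p y q → B.CohomEq i (Φ x p) (Φ y q) → A.CohomEq i x y
      Φ-surjective : ∀ z → B.Cocycle i z →
                   Σ A.X (λ x → Σ (A.Cocycle i x) (λ p → B.CohomEq i (Φ x p) z))

  _≅H[_]_ : Complex → ℤ → Complex → Set (c ⊔ ℓ)
  A ≅H[ i ] B = CohomIso i A B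

  -- Degree of a face: dim τ = |τ| - 1, so τ has degree i iff |τ| = i + 1.
  hasDeg : ∀ {n} → ℤ → Subset n → Set
  hasDeg i τ = (+ ∣ τ ∣) ≡ i ℤ.+ ℤ.1ℤ

  -- Relative simplicial cochain complex C^*(Δ,Γ;k), with ∅ counted as a
  -- face of dimension -1.  A cochain is a function on Subset n vanishing
  -- off the faces of Δ \ Γ of the given degree.

  simplicialComplex : ∀ {n} → RelativeComplex n → Complex
  simplicialComplex {n} Ψ = record
    { X   = Subset n → Carrier
    ; _≐_ = λ φ ψ → ∀ τ → φ τ ≈ ψ τ
    ; 𝟎   = λ _ → 0#
    ; _⊕_ = λ φ ψ τ → φ τ + ψ τ
    ; _⊖_ = λ φ ψ τ → φ τ - ψ τ
    ; _⊛_ = λ a φ τ → a * φ τ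
    ; d   = λ φ τ → [ relFace Ψ τ ]
                      (sumFin (λ v → [ memᵇ v τ ]
                        (signPow (position v τ) * φ (remove τ v))))
    ; Deg = λ i φ → ∀ τ → ¬ (hasDeg i τ × relFace Ψ τ ≡ true) → φ τ ≈ 0#
    }

  -- P^i = ⊕_{τ ∈ Δ, dim τ = i} k[st_τ Ψ]
  -- (for i = -1 the only τ is ∅ and k[st_∅ Ψ] = k[Ψ]).  An element is a
  -- function  τ ↦ (monomial ↦ coefficient)  which is zero unless τ has
  -- degree i and the monomial is a basis monomial of k[st_τ Ψ], and which
  -- has finite support.

  -- sign of the differential: + for ρ = ∅ (the map P^{-1} → P^0),
  -- otherwise (-1)^j with j the (1-indexed) position of the new vertex in τ
  partSign : ∀ {n} → Fin n → Subset n → Carrier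
  partSign v τ with ∣ τ ∣
  ... | 1 = 1#
  ... | _ = signPow (position v τ)

  FinSupp : ∀ {n} → (Subset n → Monomial n → Carrier) → Set ℓ
  FinSupp {n} f = ∃ λ (B : ℕ) → ∀ τ m → (∃ λ (v : Fin n) → B ℕ.< lookup m v) → f τ m ≈ 0#

  partitionComplex : ∀ {n} → RelativeComplex n → Complex
  partitionComplex {n} Ψ = record
    { X   = Subset n → Monomial n → Carrier
    ; _≐_ = λ f g → ∀ τ m → f τ m ≈ g τ m
    ; 𝟎   = λ _ _ → 0#
    ; _⊕_ = λ f g τ m → f τ m + g τ m
    ; _⊖_ = λ f g τ m → f τ m - g τ m
    ; _⊛_ = λ a f τ m → a * f τ m
      -- d(α e_ρ) = Σ_{τ = ρ ∪ {v}} ± (restriction of α to k[st_τ Ψ]) e_τ;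
      -- the restriction keeps the monomials lying in k[st_τ Ψ], kills the rest
    ; d   = λ f τ m → [ inStar Ψ τ m ]
                        (sumFin (λ v → [ memᵇ v τ ]
                          (partSign v τ * f (remove τ v) m)))
    ; Deg = λ i f → FinSupp f ×
                    (∀ τ m → ¬ (hasDeg i τ × inStar Ψ τ m ≡ true) → f τ m ≈ 0#)
    }

module Submission where

-- Both complexes are indexed by faces τ, and P*(Ψ) moreover by monomials m;
-- its differential preserves m, so P*(Ψ) splits as a sum over monomials.
-- The summand of the constant monomial 𝟘 is the simplicial cochain complex
-- C*(Ψ), up to the sign `twist` (-1 on the empty face) that converts the
-- sign convention of P (+1 on the edges ∅ ⊂ {v}) into the simplicial one.
-- For a monomial divisible by x_w, the faces τ with supp m ∪ τ ∈ Ψ form a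
-- cone with apex w, and the cone operator contracts that summand.  Hence
-- restriction to 𝟘 (`restrict`) is an isomorphism on cohomology, with
-- inverse induced by `extend`.

open import Defs
open import Data.Nat using (ℕ)
open import Data.Integer using (ℤ)
open import Level using (Level)

open import Data.Bool using (Bool; true; false; not)
open import Data.Nat as ℕ using (zero; suc; s≤s)
open import Data.Nat.Properties using (suc-injective; n≮0; <⇒≤; 0≢1+n; ≤-<-trans; m≤m⊔n; m≤n⊔m)
import Data.Integer as ℤ
open import Data.Integer.Tactic.RingSolver using (solve-∀)
open import Data.Fin using (Fin; punchIn) renaming (zero to fz; suc to fs)
import Data.Fin as Fin
open import Data.Fin.Properties using (<-cmp; punchInᵢ≢i) renaming (≤-refl to ≤ᶠ-refl)
open import Data.Fin.Subset using (Subset; ∣_∣; _∪_)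
open import Data.Vec using ([]; _∷_; lookup; replicate; _[_]≔_)
import Data.Vec.Functional as Vector
open import Data.Vec.Properties
  using (lookup∘update; lookup∘update′; []≔-idempotent; []≔-commutes; []≔-lookup; lookup-replicate)
open import Data.Empty using (⊥; ⊥-elim)
open import Data.Product using (Σ; _×_; _,_; ∃; proj₁)
open import Relation.Nullary using (¬_)
open import Relation.Binary.Definitions using (Tri; tri<; tri≈; tri>)
open import Relation.Binary.PropositionalEquality
  using (_≡_; _≢_; refl; sym; trans; cong; cong₂; subst; module ≡-Reasoning)

insert : ∀ {n} → Subset n → Fin n → Subset n
insert τ w = τ [ w ]≔ true

restore : ∀ {n} (τ : Subset n) w {b b′} → lookup τ w ≡ b → (τ [ w ]≔ b′) [ w ]≔ b ≡ τ
restore τ w {b′ = b′} τw≡b = begin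
  (τ [ w ]≔ b′) [ w ]≔ _  ≡⟨ []≔-idempotent τ w ⟩
  τ [ w ]≔ _              ≡⟨ cong (τ [ w ]≔_) (sym τw≡b) ⟩
  τ [ w ]≔ lookup τ w     ≡⟨ []≔-lookup τ w ⟩
  τ                       ∎
  where open ≡-Reasoning

insert-remove : ∀ {n} (τ : Subset n) w → lookup τ w ≡ true → insert (remove τ w) w ≡ τ
insert-remove τ w = restore τ w

remove-insert : ∀ {n} (τ : Subset n) w → lookup τ w ≡ false → remove (insert τ w) w ≡ τ
remove-insert τ w = restore τ w

size-insert : ∀ {n} (τ : Subset n) w → lookup τ w ≡ false → ∣ insert τ w ∣ ≡ suc ∣ τ ∣
size-insert (false ∷ τ) fz     _   = refl
size-insert (true  ∷ τ) (fs w) w∉τ = cong suc (size-insert τ w w∉τ)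
size-insert (false ∷ τ) (fs w) w∉τ = size-insert τ w w∉τ

size-remove : ∀ {n} (τ : Subset n) v → lookup τ v ≡ true → ∣ τ ∣ ≡ suc ∣ remove τ v ∣
size-remove τ v v∈τ = begin
  ∣ τ ∣                       ≡⟨ cong ∣_∣ (sym (insert-remove τ v v∈τ)) ⟩
  ∣ insert (remove τ v) v ∣   ≡⟨ size-insert (remove τ v) v (lookup∘update v τ false) ⟩
  suc ∣ remove τ v ∣          ∎
  where open ≡-Reasoning

degree-facet : ∀ k i → ℤ.+ suc k ≡ i ℤ.+ ℤ.1ℤ → ℤ.+ k ≡ (i ℤ.- ℤ.1ℤ) ℤ.+ ℤ.1ℤ
degree-facet k i size = begin
  ℤ.+ k                             ≡⟨ add-then-subtract (ℤ.+ k) ⟩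
  (ℤ.1ℤ ℤ.+ ℤ.+ k) ℤ.- ℤ.1ℤ         ≡⟨ cong (ℤ._- ℤ.1ℤ) size ⟩
  (i ℤ.+ ℤ.1ℤ) ℤ.- ℤ.1ℤ             ≡⟨ reassociate i ⟩
  (i ℤ.- ℤ.1ℤ) ℤ.+ ℤ.1ℤ             ∎
  where
  open ≡-Reasoning
  add-then-subtract : ∀ j → j ≡ (ℤ.1ℤ ℤ.+ j) ℤ.- ℤ.1ℤ
  add-then-subtract = solve-∀
  reassociate : ∀ i → (i ℤ.+ ℤ.1ℤ) ℤ.- ℤ.1ℤ ≡ (i ℤ.- ℤ.1ℤ) ℤ.+ ℤ.1ℤ
  reassociate = solve-∀

𝟘 : ∀ {n} → Monomial n
𝟘 {n} = replicate n 0

supp-𝟘-∪ : ∀ {n} (τ : Subset n) → supp 𝟘 ∪ τ ≡ τ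
supp-𝟘-∪ []      = refl
supp-𝟘-∪ (b ∷ τ) = cong (b ∷_) (supp-𝟘-∪ τ)

supp-∪-insert : ∀ {n} (m : Monomial n) τ w → lookup (supp m) w ≡ true →
                supp m ∪ insert τ w ≡ supp m ∪ τ
supp-∪-insert (suc k ∷ m) (b ∷ τ) fz     w∈m = refl
supp-∪-insert (k ∷ m)     (b ∷ τ) (fs w) w∈m = cong (_ ∷_) (supp-∪-insert m τ w w∈m)

data MonomialView {n} (m : Monomial n) : Set where
  constant : m ≡ 𝟘 → MonomialView m
  divisibleBy : (w : Fin n) → lookup (supp m) w ≡ true → MonomialView m

view : ∀ {n} (m : Monomial n) → MonomialView m
view []          = constant refl
view (suc k ∷ m) = divisibleBy fz refl
view (zero ∷ m)  with view m
... | constant m≡𝟘   = constant (cong (0 ∷_) m≡𝟘)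
... | divisibleBy w w∈m = divisibleBy (fs w) w∈m

𝟘-has-no-variable : ∀ {n} (w : Fin n) → lookup (supp (𝟘 {n})) w ≡ true → ⊥
𝟘-has-no-variable {suc n} fz     ()
𝟘-has-no-variable {suc n} (fs w) w∈𝟘 = 𝟘-has-no-variable w w∈𝟘

𝟘-below-every-bound : ∀ {n} B (v : Fin n) → B ℕ.< lookup (𝟘 {n}) v → ⊥
𝟘-below-every-bound B v B<𝟘v = n≮0 (subst (B ℕ.<_) (lookup-replicate v 0) B<𝟘v)

-- Positions: position v τ = 1 + #{u ∈ τ : u < v}.  The function lives in
-- OverField K but does not depend on the field.

module Positions {c ℓ} (K : Field c ℓ) where

  open OverField K using (position)

  position-fz : ∀ {n} (τ : Subset (suc n)) → position fz τ ≡ 1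
  position-fz (true  ∷ [])    = refl
  position-fz (false ∷ [])    = refl
  position-fz (true  ∷ b ∷ τ) = position-fz (b ∷ τ)
  position-fz (false ∷ b ∷ τ) = position-fz (b ∷ τ)

  position-insert-after : ∀ {n} {v w : Fin n} (τ : Subset n) → v Fin.≤ w →
                          position v (insert τ w) ≡ position v τ
  position-insert-after {v = fz}   τ              _         = trans (position-fz (insert τ _)) (sym (position-fz τ))
  position-insert-after {v = fs v} {fs w} (true  ∷ τ) (s≤s v≤w) = cong suc (position-insert-after τ v≤w)
  position-insert-after {v = fs v} {fs w} (false ∷ τ) (s≤s v≤w) = position-insert-after τ v≤w

  position-insert-before : ∀ {n} {v w : Fin n} (τ : Subset n) → w Fin.< v → lookup τ w ≡ false →
                           position v (insert τ w) ≡ suc (position v τ)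
  position-insert-before {v = fs v} {fz}   (false ∷ τ) _         _   = refl
  position-insert-before {v = fs v} {fs w} (true  ∷ τ) (s≤s w<v) w∉τ = cong suc (position-insert-before τ w<v w∉τ)
  position-insert-before {v = fs v} {fs w} (false ∷ τ) (s≤s w<v) w∉τ = position-insert-before τ w<v w∉τ

  position-empty : ∀ {n} (v : Fin n) (τ : Subset n) → ∣ τ ∣ ≡ 0 → position v τ ≡ 1
  position-empty fz     τ           _     = position-fz τ
  position-empty (fs v) (false ∷ τ) empty = position-empty v τ empty

  position-singleton : ∀ {n} (v : Fin n) τ → lookup τ v ≡ true → ∣ τ ∣ ≡ 1 → position v τ ≡ 1
  position-singleton v τ v∈τ single = begin
    position v τ                       ≡⟨ cong (position v) (sym (insert-remove τ v v∈τ)) ⟩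
    position v (insert (remove τ v) v) ≡⟨ position-insert-after (remove τ v) ≤ᶠ-refl ⟩
    position v (remove τ v)            ≡⟨ position-empty v (remove τ v)
                                            (suc-injective (trans (sym (size-remove τ v v∈τ)) single)) ⟩
    1                                  ∎
    where open ≡-Reasoning

module OverK {c ℓ} (K : Field c ℓ) where

  open Field K renaming (refl to ≈-refl; sym to ≈-sym; trans to ≈-trans)
  open OverField K
  open Positions K
  open import Algebra.Properties.Ring ring using (-‿involutive; -‿distribˡ-*; -‿distribʳ-*; x[y-z]≈xy-xz; -1*x≈-x)
  open import Algebra.Properties.CommutativeMonoid.Sum +-commutativeMonoid
    using (sum; sum-cong-≋; ∑-distrib-+; sum-remove; sum-replicate-zero)
  open import Algebra.Properties.Semiring.Sum semiring using (*-distribˡ-sum)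
  open import Algebra.Properties.CommutativeSemigroup *-commutativeSemigroup using (x∙yz≈y∙xz)
  open import Relation.Binary.Reasoning.Setoid setoid

  IsSign : Carrier → Set ℓ
  IsSign e = e * e ≈ 1#

  neg-neg : ∀ x y → (- x) * (- y) ≈ x * y
  neg-neg x y = begin
    (- x) * (- y)  ≈⟨ ≈-sym (-‿distribˡ-* x (- y)) ⟩
    - (x * (- y))  ≈⟨ -‿cong (≈-sym (-‿distribʳ-* x y)) ⟩
    - (- (x * y))  ≈⟨ -‿involutive (x * y) ⟩
    x * y          ∎

  1-sign : IsSign 1#
  1-sign = *-identityˡ 1#

  neg-sign : ∀ {e} → IsSign e → IsSign (- e)
  neg-sign {e} e² = ≈-trans (neg-neg e e) e²

  signPow-sign : ∀ k → IsSign (signPow k)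
  signPow-sign zero    = 1-sign
  signPow-sign (suc k) = neg-sign (signPow-sign k)

  sign-cancel : ∀ {e} x → IsSign e → e * (e * x) ≈ x
  sign-cancel {e} x e² = begin
    e * (e * x)  ≈⟨ ≈-sym (*-assoc e e x) ⟩
    (e * e) * x  ≈⟨ *-congʳ e² ⟩
    1# * x       ≈⟨ *-identityˡ x ⟩
    x            ∎

  sign-square : ∀ {e} x y → IsSign e → (e * x) * (e * y) ≈ x * y
  sign-square {e} x y e² = begin
    (e * x) * (e * y)  ≈⟨ *-assoc e x (e * y) ⟩
    e * (x * (e * y))  ≈⟨ *-congˡ (x∙yz≈y∙xz x e y) ⟩
    e * (e * (x * y))  ≈⟨ sign-cancel (x * y) e² ⟩
    x * y              ∎

  *-sign : ∀ {a b} → IsSign a → IsSign b → IsSign (a * b)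
  *-sign {a} {b} a² b² = ≈-trans (sign-square b b a²) b²

  commute-neg-left : ∀ x y → x * y ≈ - ((- y) * x)
  commute-neg-left x y = begin
    x * y          ≈⟨ *-comm x y ⟩
    y * x          ≈⟨ ≈-sym (-‿involutive (y * x)) ⟩
    - (- (y * x))  ≈⟨ -‿cong (-‿distribˡ-* y x) ⟩
    - ((- y) * x)  ∎

  commute-neg-right : ∀ x y → x * y ≈ - (y * (- x))
  commute-neg-right x y = begin
    x * y          ≈⟨ *-comm x y ⟩
    y * x          ≈⟨ ≈-sym (-‿involutive (y * x)) ⟩
    - (- (y * x))  ≈⟨ -‿cong (-‿distribʳ-* y x) ⟩
    - (y * (- x))  ∎

  -- The simplicial one is
  -- (-1)^position; the partition complex agrees with it except on the edges
  -- ∅ ⊂ {v}, where it uses +1.  The factor `twist` (-1 on the empty face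
  -- only) converts one convention into the other.

  twist : ℕ → Carrier
  twist zero    = - 1#
  twist (suc _) = 1#

  twist-sign : ∀ k → IsSign (twist k)
  twist-sign zero    = neg-sign 1-sign
  twist-sign (suc _) = 1-sign

  simplicialSign : ∀ {n} → Fin n → Subset n → Carrier
  simplicialSign v τ = signPow (position v τ)

  partSign≈ : ∀ {n} (v : Fin n) τ → lookup τ v ≡ true →
              partSign v τ ≈ twist (ℕ.pred ∣ τ ∣) * simplicialSign v τ
  partSign≈ v τ v∈τ with ∣ τ ∣ in size
  ... | zero        = ⊥-elim (0≢1+n (trans (sym size) (size-remove τ v v∈τ)))
  ... | suc (suc _) = ≈-sym (*-identityˡ _)
  ... | suc zero    = begin
    1#                             ≈⟨ ≈-sym (neg-sign 1-sign) ⟩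
    - 1# * - 1#                    ≡⟨ cong (λ k → - 1# * signPow k) (sym (position-singleton v τ v∈τ size)) ⟩
    - 1# * signPow (position v τ)  ∎

  partSign-sign : ∀ {n} (v : Fin n) τ → lookup τ v ≡ true → IsSign (partSign v τ)
  partSign-sign v τ v∈τ = ≈-trans (*-cong ps ps) (*-sign (twist-sign (ℕ.pred ∣ τ ∣)) (signPow-sign (position v τ)))
    where
    ps : partSign v τ ≈ twist (ℕ.pred ∣ τ ∣) * simplicialSign v τ
    ps = partSign≈ v τ v∈τ

  -- on two faces of the same size the twists cancel
  partSign-pair : ∀ {n} {v w : Fin n} τ σ → ∣ σ ∣ ≡ ∣ τ ∣ → lookup τ v ≡ true → lookup σ w ≡ true →
                  partSign v τ * partSign w σ ≈ simplicialSign v τ * simplicialSign w σ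
  partSign-pair {v = v} {w} τ σ |σ|≡|τ| v∈τ w∈σ = begin
    partSign v τ * partSign w σ
      ≈⟨ *-cong (partSign≈ v τ v∈τ) (partSign≈ w σ w∈σ) ⟩
    (twist (ℕ.pred ∣ τ ∣) * simplicialSign v τ) * (twist (ℕ.pred ∣ σ ∣) * simplicialSign w σ)
      ≡⟨ cong (λ k → (twist (ℕ.pred ∣ τ ∣) * simplicialSign v τ) * (twist (ℕ.pred k) * simplicialSign w σ)) |σ|≡|τ| ⟩
    (twist (ℕ.pred ∣ τ ∣) * simplicialSign v τ) * (twist (ℕ.pred ∣ τ ∣) * simplicialSign w σ)
      ≈⟨ sign-square (simplicialSign v τ) (simplicialSign w σ) (twist-sign (ℕ.pred ∣ τ ∣)) ⟩
    simplicialSign v τ * simplicialSign w σ ∎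

  -- In the square of faces ρ ⊂ τ, ρ + w ⊂ τ + w (ρ = τ - v, w ∉ τ) the signs
  -- of the two lower edges multiply to minus those of the two upper edges;
  -- this is what makes the cone operator below a contraction.
  partSign-square : ∀ {n} {v w : Fin n} τ → v ≢ w → lookup τ v ≡ true → lookup τ w ≡ false →
                    partSign v τ * partSign w (insert (remove τ v) w)
                      ≈ - (partSign w (insert τ w) * partSign v (insert τ w))
  partSign-square {v = v} {w} τ v≢w v∈τ w∉τ = begin
    partSign v τ * partSign w σ                      ≈⟨ partSign-pair τ σ |σ|≡|τ| v∈τ w∈σ ⟩
    signPow a * signPow (position w σ)               ≡⟨ cong (λ k → signPow a * signPow k) (position-insert-after ρ ≤ᶠ-refl) ⟩
    signPow a * signPow b                            ≈⟨ reorder (<-cmp v w) ⟩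
    - (simplicialSign w τ′ * simplicialSign v τ′)    ≈⟨ -‿cong (≈-sym (partSign-pair τ′ τ′ refl w∈τ′ v∈τ′)) ⟩
    - (partSign w τ′ * partSign v τ′)                ∎
    where
    ρ σ τ′ : Subset _
    ρ  = remove τ v
    σ  = insert ρ w
    τ′ = insert τ w
    a b : ℕ
    a = position v τ
    b = position w ρ
    v∉ρ : lookup ρ v ≡ false
    v∉ρ = lookup∘update v τ false
    w∉ρ : lookup ρ w ≡ false
    w∉ρ = trans (lookup∘update′ (λ w≡v → v≢w (sym w≡v)) τ false) w∉τ
    w∈σ : lookup σ w ≡ true
    w∈σ = lookup∘update w ρ true
    w∈τ′ : lookup τ′ w ≡ true
    w∈τ′ = lookup∘update w τ true
    v∈τ′ : lookup τ′ v ≡ true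
    v∈τ′ = trans (lookup∘update′ v≢w τ true) v∈τ
    |σ|≡|τ| : ∣ σ ∣ ≡ ∣ τ ∣
    |σ|≡|τ| = trans (size-insert ρ w w∉ρ) (sym (size-remove τ v v∈τ))
    position-w : position w τ′ ≡ position w (insert ρ v)
    position-w = trans (position-insert-after τ ≤ᶠ-refl) (cong (position w) (sym (insert-remove τ v v∈τ)))
    -- exactly one of v, w moves when the other is inserted: the later one
    reorder : Tri (v Fin.< w) (v ≡ w) (w Fin.< v) →
              signPow a * signPow b ≈ - (signPow (position w τ′) * signPow (position v τ′))
    reorder (tri< v<w _ _) = begin
      signPow a * signPow b                ≈⟨ commute-neg-left (signPow a) (signPow b) ⟩
      - (signPow (suc b) * signPow a)      ≡⟨ cong₂ (λ p q → - (signPow p * signPow q))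
                                                    (sym (trans position-w (position-insert-before ρ v<w v∉ρ)))
                                                    (sym (position-insert-after τ (<⇒≤ v<w))) ⟩
      - (signPow (position w τ′) * signPow (position v τ′)) ∎
    reorder (tri≈ _ v≡w _) = ⊥-elim (v≢w v≡w)
    reorder (tri> _ _ w<v) = begin
      signPow a * signPow b                ≈⟨ commute-neg-right (signPow a) (signPow b) ⟩
      - (signPow b * signPow (suc a))      ≡⟨ cong₂ (λ p q → - (signPow p * signPow q))
                                                    (sym (trans position-w (position-insert-after ρ (<⇒≤ w<v))))
                                                    (sym (position-insert-before τ w<v w∉τ)) ⟩
      - (signPow (position w τ′) * signPow (position v τ′)) ∎

  -- Finite sums and indicators.  sumFin is the library's `sum`, so its
  -- properties are imported through sumFin≡sum.

  sumFin≡sum : ∀ {n} (f : Fin n → Carrier) → sumFin f ≡ sum f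
  sumFin≡sum {zero}  f = refl
  sumFin≡sum {suc n} f = cong (f fz +_) (sumFin≡sum (λ v → f (fs v)))

  sumFin-cong : ∀ {n} {f g : Fin n → Carrier} → (∀ v → f v ≈ g v) → sumFin f ≈ sumFin g
  sumFin-cong {f = f} {g} f≈g = begin
    sumFin f  ≡⟨ sumFin≡sum f ⟩
    sum f     ≈⟨ sum-cong-≋ f≈g ⟩
    sum g     ≡⟨ sym (sumFin≡sum g) ⟩
    sumFin g  ∎

  sumFin-zero : ∀ {n} {f : Fin n → Carrier} → (∀ v → f v ≈ 0#) → sumFin f ≈ 0#
  sumFin-zero {n} {f} f≈0 = begin
    sumFin f             ≡⟨ sumFin≡sum f ⟩
    sum f                ≈⟨ sum-cong-≋ f≈0 ⟩
    sum (Vector.replicate n 0#) ≈⟨ sum-replicate-zero n ⟩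
    0#                   ∎

  sumFin-+ : ∀ {n} (f g : Fin n → Carrier) → sumFin (λ v → f v + g v) ≈ sumFin f + sumFin g
  sumFin-+ f g = begin
    sumFin (λ v → f v + g v)  ≡⟨ sumFin≡sum (λ v → f v + g v) ⟩
    sum (λ v → f v + g v)     ≈⟨ ∑-distrib-+ f g ⟩
    sum f + sum g             ≡⟨ sym (cong₂ _+_ (sumFin≡sum f) (sumFin≡sum g)) ⟩
    sumFin f + sumFin g       ∎

  sumFin-* : ∀ {n} a (f : Fin n → Carrier) → sumFin (λ v → a * f v) ≈ a * sumFin f
  sumFin-* a f = begin
    sumFin (λ v → a * f v)  ≡⟨ sumFin≡sum (λ v → a * f v) ⟩
    sum (λ v → a * f v)     ≈⟨ ≈-sym (*-distribˡ-sum a f) ⟩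
    a * sum f               ≡⟨ sym (cong (a *_) (sumFin≡sum f)) ⟩
    a * sumFin f            ∎

  sumFin-- : ∀ {n} (f g : Fin n → Carrier) → sumFin (λ v → f v - g v) ≈ sumFin f - sumFin g
  sumFin-- f g = begin
    sumFin (λ v → f v - g v)             ≈⟨ sumFin-+ f (λ v → - g v) ⟩
    sumFin f + sumFin (λ v → - g v)      ≈⟨ +-congˡ (sumFin-cong (λ v → ≈-sym (-1*x≈-x (g v)))) ⟩
    sumFin f + sumFin (λ v → - 1# * g v) ≈⟨ +-congˡ (sumFin-* (- 1#) g) ⟩
    sumFin f + - 1# * sumFin g           ≈⟨ +-congˡ (-1*x≈-x (sumFin g)) ⟩
    sumFin f - sumFin g                  ∎

  sumFin-single : ∀ {n} (f : Fin n → Carrier) w → (∀ v → v ≢ w → f v ≈ 0#) → sumFin f ≈ f w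
  sumFin-single {suc n} f w others≈0 = begin
    sumFin f                            ≡⟨ sumFin≡sum f ⟩
    sum f                               ≈⟨ sum-remove f ⟩
    f w + sum (Vector.removeAt f w)     ≈⟨ +-congˡ (sum-cong-≋ (λ j → others≈0 (punchIn w j) (punchInᵢ≢i w j))) ⟩
    f w + sum (Vector.replicate n 0#)   ≈⟨ +-congˡ (sum-replicate-zero n) ⟩
    f w + 0#                            ≈⟨ +-identityʳ (f w) ⟩
    f w                                 ∎

  [_]-cong : ∀ b {x y} → x ≈ y → [ b ] x ≈ [ b ] y
  [ true  ]-cong x≈y = x≈y
  [ false ]-cong _   = ≈-refl

  [_]-zero : ∀ b → [ b ] 0# ≈ 0#
  [ true  ]-zero = ≈-refl
  [ false ]-zero = ≈-refl

  [_]-+ : ∀ b x y → [ b ] (x + y) ≈ [ b ] x + [ b ] y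
  [ true  ]-+ x y = ≈-refl
  [ false ]-+ x y = ≈-sym (+-identityˡ 0#)

  [_]-- : ∀ b x y → [ b ] (x - y) ≈ [ b ] x - [ b ] y
  [ true  ]-- x y = ≈-refl
  [ false ]-- x y = ≈-sym (-‿inverseʳ 0#)

  [_]-* : ∀ b a x → a * [ b ] x ≈ [ b ] (a * x)
  [ true  ]-* a x = ≈-refl
  [ false ]-* a x = zeroʳ a

  indicator-true : ∀ {b} x → b ≡ true → [ b ] x ≡ x
  indicator-true x refl = refl

  -- By definition
  --   d_C φ τ   = coboundary (relFace Ψ) simplicialSign φ τ,
  --   d_P x τ m = coboundary (λ σ → inStar Ψ σ m) partSign (λ ρ → x ρ m) τ.

  facetTerm : ∀ {n} → (Fin n → Subset n → Carrier) → (Subset n → Carrier) → Subset n → Fin n → Carrier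
  facetTerm s f τ v = [ memᵇ v τ ] (s v τ * f (remove τ v))

  coboundary : ∀ {n} → (Subset n → Bool) → (Fin n → Subset n → Carrier) →
               (Subset n → Carrier) → Subset n → Carrier
  coboundary b s f τ = [ b τ ] (sumFin (facetTerm s f τ))

  module _ {n} (b : Subset n → Bool) (s : Fin n → Subset n → Carrier) where

    coboundary-cong : ∀ {f g} → (∀ ρ → f ρ ≈ g ρ) → ∀ τ → coboundary b s f τ ≈ coboundary b s g τ
    coboundary-cong f≈g τ =
      [ b τ ]-cong (sumFin-cong (λ v → [ memᵇ v τ ]-cong (*-congˡ (f≈g (remove τ v)))))

    coboundary-zero : ∀ {f} → (∀ ρ → f ρ ≈ 0#) → ∀ τ → coboundary b s f τ ≈ 0#
    coboundary-zero f≈0 τ = ≈-trans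
      ([ b τ ]-cong (sumFin-zero (λ v → ≈-trans ([ memᵇ v τ ]-cong (≈-trans (*-congˡ (f≈0 (remove τ v))) (zeroʳ _)))
                                                ([ memᵇ v τ ]-zero))))
      ([ b τ ]-zero)

    coboundary-+ : ∀ f g τ → coboundary b s (λ ρ → f ρ + g ρ) τ ≈ coboundary b s f τ + coboundary b s g τ
    coboundary-+ f g τ =
      ≈-trans ([ b τ ]-cong (≈-trans (sumFin-cong term) (sumFin-+ (facetTerm s f τ) (facetTerm s g τ)))) ([ b τ ]-+ _ _)
      where
      term : ∀ v → facetTerm s (λ ρ → f ρ + g ρ) τ v ≈ facetTerm s f τ v + facetTerm s g τ v
      term v = ≈-trans ([ memᵇ v τ ]-cong (distribˡ _ _ _)) ([ memᵇ v τ ]-+ _ _)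

    coboundary-- : ∀ f g τ → coboundary b s (λ ρ → f ρ - g ρ) τ ≈ coboundary b s f τ - coboundary b s g τ
    coboundary-- f g τ =
      ≈-trans ([ b τ ]-cong (≈-trans (sumFin-cong term) (sumFin-- (facetTerm s f τ) (facetTerm s g τ)))) ([ b τ ]-- _ _)
      where
      term : ∀ v → facetTerm s (λ ρ → f ρ - g ρ) τ v ≈ facetTerm s f τ v - facetTerm s g τ v
      term v = ≈-trans ([ memᵇ v τ ]-cong (x[y-z]≈xy-xz _ _ _)) ([ memᵇ v τ ]-- _ _)

  twist-partSign : ∀ {n} (v : Fin n) τ → lookup τ v ≡ true →
                   twist ∣ τ ∣ * partSign v τ ≈ simplicialSign v τ * twist ∣ remove τ v ∣
  twist-partSign v τ v∈τ = begin
    twist ∣ τ ∣ * partSign v τ                                 ≈⟨ *-congˡ (partSign≈ v τ v∈τ) ⟩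
    twist ∣ τ ∣ * (twist (ℕ.pred ∣ τ ∣) * simplicialSign v τ)   ≡⟨ cong (λ k → twist k * (twist (ℕ.pred k) * simplicialSign v τ))
                                                                         (size-remove τ v v∈τ) ⟩
    1# * (twist ∣ remove τ v ∣ * simplicialSign v τ)           ≈⟨ *-identityˡ _ ⟩
    twist ∣ remove τ v ∣ * simplicialSign v τ                  ≈⟨ *-comm _ _ ⟩
    simplicialSign v τ * twist ∣ remove τ v ∣                  ∎

  twist-coboundary : ∀ {n} (b : Subset n → Bool) f τ →
                     twist ∣ τ ∣ * coboundary b partSign f τ
                       ≈ coboundary b simplicialSign (λ ρ → twist ∣ ρ ∣ * f ρ) τ
  twist-coboundary b f τ = begin
    twist ∣ τ ∣ * [ b τ ] (sumFin (facetTerm partSign f τ))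
      ≈⟨ [ b τ ]-* _ _ ⟩
    [ b τ ] (twist ∣ τ ∣ * sumFin (facetTerm partSign f τ))
      ≈⟨ [ b τ ]-cong (≈-sym (sumFin-* (twist ∣ τ ∣) (facetTerm partSign f τ))) ⟩
    [ b τ ] (sumFin (λ v → twist ∣ τ ∣ * facetTerm partSign f τ v))
      ≈⟨ [ b τ ]-cong (sumFin-cong twisted) ⟩
    coboundary b simplicialSign (λ ρ → twist ∣ ρ ∣ * f ρ) τ ∎
    where
    twisted : ∀ v → twist ∣ τ ∣ * facetTerm partSign f τ v
                      ≈ facetTerm simplicialSign (λ ρ → twist ∣ ρ ∣ * f ρ) τ v
    twisted v with lookup τ v in v∈τ
    ... | false = zeroʳ _
    ... | true  = begin
      twist ∣ τ ∣ * (partSign v τ * f (remove τ v))                       ≈⟨ ≈-sym (*-assoc _ _ _) ⟩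
      (twist ∣ τ ∣ * partSign v τ) * f (remove τ v)                       ≈⟨ *-congʳ (twist-partSign v τ v∈τ) ⟩
      (simplicialSign v τ * twist ∣ remove τ v ∣) * f (remove τ v)        ≈⟨ *-assoc _ _ _ ⟩
      simplicialSign v τ * (twist ∣ remove τ v ∣ * f (remove τ v))        ∎

  untwist-coboundary : ∀ {n} (b : Subset n → Bool) f τ →
                       coboundary b partSign (λ ρ → twist ∣ ρ ∣ * f ρ) τ
                         ≈ twist ∣ τ ∣ * coboundary b simplicialSign f τ
  untwist-coboundary b f τ = begin
    coboundary b partSign (λ ρ → twist ∣ ρ ∣ * f ρ) τ
      ≈⟨ ≈-sym (sign-cancel _ (twist-sign ∣ τ ∣)) ⟩
    twist ∣ τ ∣ * (twist ∣ τ ∣ * coboundary b partSign (λ ρ → twist ∣ ρ ∣ * f ρ) τ)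
      ≈⟨ *-congˡ (twist-coboundary b (λ ρ → twist ∣ ρ ∣ * f ρ) τ) ⟩
    twist ∣ τ ∣ * coboundary b simplicialSign (λ ρ → twist ∣ ρ ∣ * (twist ∣ ρ ∣ * f ρ)) τ
      ≈⟨ *-congˡ (coboundary-cong b simplicialSign (λ ρ → sign-cancel (f ρ) (twist-sign ∣ ρ ∣)) τ) ⟩
    twist ∣ τ ∣ * coboundary b simplicialSign f τ ∎

  coneOp : ∀ {n} → Fin n → (Subset n → Carrier) → Subset n → Carrier
  coneOp w f ρ = [ not (memᵇ w ρ) ] (partSign w (insert ρ w) * f (insert ρ w))

  opposite-terms-cancel : ∀ a b c d x → a * b ≈ - (c * d) → a * (b * x) + c * (d * x) ≈ 0#
  opposite-terms-cancel a b c d x ab≈-cd = begin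
    a * (b * x) + c * (d * x)        ≈⟨ +-cong (≈-sym (*-assoc a b x)) (≈-sym (*-assoc c d x)) ⟩
    (a * b) * x + (c * d) * x        ≈⟨ ≈-sym (distribʳ x (a * b) (c * d)) ⟩
    (a * b + c * d) * x              ≈⟨ *-congʳ (+-congʳ ab≈-cd) ⟩
    (- (c * d) + c * d) * x          ≈⟨ *-congʳ (-‿inverseˡ (c * d)) ⟩
    0# * x                           ≈⟨ zeroˡ x ⟩
    0#                               ∎

  module _ {n} (w : Fin n) (f : Subset n → Carrier) where

    coneOp-apex : ∀ ρ → lookup ρ w ≡ true → coneOp w f ρ ≡ 0#
    coneOp-apex ρ w∈ρ = cong (λ b → [ not b ] (partSign w (insert ρ w) * f (insert ρ w))) w∈ρ

    coneOp-base : ∀ ρ → lookup ρ w ≡ false → coneOp w f ρ ≡ partSign w (insert ρ w) * f (insert ρ w)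
    coneOp-base ρ w∉ρ = cong (λ b → [ not b ] (partSign w (insert ρ w) * f (insert ρ w))) w∉ρ

    -- if τ contains the apex, only the facet τ - w contributes to d (coneOp w f) τ
    cone-apex-inside : ∀ τ → lookup τ w ≡ true → sumFin (facetTerm partSign (coneOp w f) τ) ≈ f τ
    cone-apex-inside τ w∈τ = begin
      sumFin (facetTerm partSign (coneOp w f) τ)
        ≈⟨ sumFin-single (facetTerm partSign (coneOp w f) τ) w others ⟩
      [ memᵇ w τ ] (partSign w τ * coneOp w f (remove τ w))
        ≡⟨ indicator-true _ w∈τ ⟩
      partSign w τ * coneOp w f (remove τ w)
        ≡⟨ cong (partSign w τ *_) (coneOp-base (remove τ w) (lookup∘update w τ false)) ⟩
      partSign w τ * (partSign w (insert (remove τ w) w) * f (insert (remove τ w) w))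
        ≡⟨ cong (λ σ → partSign w τ * (partSign w σ * f σ)) (insert-remove τ w w∈τ) ⟩
      partSign w τ * (partSign w τ * f τ)
        ≈⟨ sign-cancel (f τ) (partSign-sign w τ w∈τ) ⟩
      f τ ∎
      where
      others : ∀ v → v ≢ w → facetTerm partSign (coneOp w f) τ v ≈ 0#
      others v v≢w = ≈-trans ([ memᵇ v τ ]-cong (≈-trans (*-congˡ (reflexive apex)) (zeroʳ _))) ([ memᵇ v τ ]-zero)
        where
        apex : coneOp w f (remove τ v) ≡ 0#
        apex = coneOp-apex (remove τ v) (trans (lookup∘update′ (λ w≡v → v≢w (sym w≡v)) τ false) w∈τ)

    -- for v ≠ w and τ avoiding w, the summand of d (coneOp w f) τ at v cancels
    -- against the summand of d f (τ + w) at v (by the sign of the square)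
    cone-summands-cancel : ∀ τ → lookup τ w ≡ false → ∀ v → v ≢ w →
                           facetTerm partSign (coneOp w f) τ v
                             + partSign w (insert τ w) * facetTerm partSign f (insert τ w) v ≈ 0#
    cone-summands-cancel τ w∉τ v v≢w with lookup τ v in τv
    ... | false = begin
      0# + p′ * [ lookup τ′ v ] (partSign v τ′ * f (remove τ′ v))
        ≡⟨ cong (λ c → 0# + p′ * [ c ] (partSign v τ′ * f (remove τ′ v))) (trans (lookup∘update′ v≢w τ true) τv) ⟩
      0# + p′ * 0#                           ≈⟨ +-identityˡ _ ⟩
      p′ * 0#                                ≈⟨ zeroʳ p′ ⟩
      0#                                     ∎
      where
      τ′ : Subset n
      τ′ = insert τ w
      p′ : Carrier
      p′ = partSign w τ′
    ... | true = begin
      partSign v τ * coneOp w f ρ + p′ * [ lookup τ′ v ] (partSign v τ′ * f (remove τ′ v))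
        ≡⟨ cong₂ (λ x c → partSign v τ * x + p′ * [ c ] (partSign v τ′ * f (remove τ′ v)))
                 (coneOp-base ρ w∉ρ) (trans (lookup∘update′ v≢w τ true) τv) ⟩
      partSign v τ * (partSign w σ * f σ) + p′ * (partSign v τ′ * f (remove τ′ v))
        ≡⟨ cong (λ ς → partSign v τ * (partSign w σ * f σ) + p′ * (partSign v τ′ * f ς)) remove-insert-comm ⟩
      partSign v τ * (partSign w σ * f σ) + p′ * (partSign v τ′ * f σ)
        ≈⟨ opposite-terms-cancel _ _ _ _ (f σ) (partSign-square τ v≢w τv w∉τ) ⟩
      0#                                     ∎
      where
      ρ σ τ′ : Subset n
      ρ  = remove τ v
      σ  = insert ρ w
      τ′ = insert τ w
      p′ : Carrier
      p′ = partSign w τ′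
      w∉ρ : lookup ρ w ≡ false
      w∉ρ = trans (lookup∘update′ (λ w≡v → v≢w (sym w≡v)) τ false) w∉τ
      remove-insert-comm : remove τ′ v ≡ σ
      remove-insert-comm = []≔-commutes τ w v (λ w≡v → v≢w (sym w≡v))

    -- if τ avoids the apex, d (coneOp w f) τ is computed from the cocycle
    -- condition at τ + w: its summands cancel those of d f (τ + w) except one
    cone-apex-outside : (b : Subset n → Bool) → (∀ τ → b (insert τ w) ≡ b τ) →
                        (∀ τ → coboundary b partSign f τ ≈ 0#) →
                        ∀ τ → b τ ≡ true → lookup τ w ≡ false →
                        sumFin (facetTerm partSign (coneOp w f) τ) ≈ f τ
    cone-apex-outside b cone closed τ selected w∉τ = begin
      sumFin T                                ≈⟨ ≈-sym (+-identityʳ _) ⟩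
      sumFin T + 0#                           ≈⟨ +-congˡ (≈-sym (≈-trans (*-congˡ ΣU≈0) (zeroʳ p′))) ⟩
      sumFin T + p′ * sumFin U                ≈⟨ +-congˡ (≈-sym (sumFin-* p′ U)) ⟩
      sumFin T + sumFin (λ v → p′ * U v)      ≈⟨ ≈-sym (sumFin-+ T (λ v → p′ * U v)) ⟩
      sumFin (λ v → T v + p′ * U v)           ≈⟨ sumFin-single (λ v → T v + p′ * U v) w (cone-summands-cancel τ w∉τ) ⟩
      T w + p′ * U w                          ≈⟨ at-apex ⟩
      f τ                                     ∎
      where
      τ′ : Subset n
      τ′ = insert τ w
      p′ : Carrier
      p′ = partSign w τ′
      T U : Fin n → Carrier
      T = facetTerm partSign (coneOp w f) τ
      U = facetTerm partSign f τ′
      w∈τ′ : lookup τ′ w ≡ true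
      w∈τ′ = lookup∘update w τ true
      ΣU≈0 : sumFin U ≈ 0#
      ΣU≈0 = ≈-trans (reflexive (sym (indicator-true (sumFin U) (trans (cone τ) selected)))) (closed τ′)
      at-apex : T w + p′ * U w ≈ f τ
      at-apex = begin
        T w + p′ * U w
          ≡⟨ cong₂ (λ a c → [ a ] (partSign w τ * coneOp w f (remove τ w)) + p′ * [ c ] (p′ * f (remove τ′ w)))
                   w∉τ w∈τ′ ⟩
        0# + p′ * (p′ * f (remove τ′ w))       ≡⟨ cong (λ σ → 0# + p′ * (p′ * f σ)) (remove-insert τ w w∉τ) ⟩
        0# + p′ * (p′ * f τ)                   ≈⟨ +-identityˡ _ ⟩
        p′ * (p′ * f τ)                        ≈⟨ sign-cancel (f τ) (partSign-sign w τ′ w∈τ′) ⟩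
        f τ                                    ∎

    cone-acyclic : (b : Subset n → Bool) → (∀ τ → b (insert τ w) ≡ b τ) →
                   (∀ τ → b τ ≡ false → f τ ≈ 0#) → (∀ τ → coboundary b partSign f τ ≈ 0#) →
                   ∀ τ → f τ ≈ coboundary b partSign (coneOp w f) τ
    cone-acyclic b cone supported closed τ with b τ in selected | lookup τ w in τw
    ... | false | _     = supported τ selected
    ... | true  | true  = ≈-sym (cone-apex-inside τ τw)
    ... | true  | false = ≈-sym (cone-apex-outside b cone closed τ selected τw)

    coneOp-vanishes : ∀ ρ → (lookup ρ w ≡ false → f (insert ρ w) ≈ 0#) → coneOp w f ρ ≈ 0#
    coneOp-vanishes ρ base-vanishes with lookup ρ w
    ... | true  = ≈-refl
    ... | false = ≈-trans (*-congˡ (base-vanishes refl)) (zeroʳ _)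

module Comparison {c ℓ} (K : Field c ℓ) {n : ℕ} (Ψ : RelativeComplex n) where

  open Field K renaming (refl to ≈-refl; sym to ≈-sym; trans to ≈-trans)
  open OverField K
  open OverK K
  open import Algebra.Properties.Ring ring using (x[y-z]≈xy-xz)
  open import Algebra.Properties.CommutativeSemigroup *-commutativeSemigroup using (x∙yz≈y∙xz)
  open import Relation.Binary.Reasoning.Setoid setoid

  module P = Complex (partitionComplex Ψ)
  module C = Complex (simplicialComplex Ψ)

  inStar-𝟘 : ∀ τ → inStar Ψ τ 𝟘 ≡ relFace Ψ τ
  inStar-𝟘 τ = cong (relFace Ψ) (supp-𝟘-∪ τ)

  -- for a monomial divisible by x_w, the stars form a cone with apex w
  inStar-insert : ∀ m τ w → lookup (supp m) w ≡ true → inStar Ψ (insert τ w) m ≡ inStar Ψ τ m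
  inStar-insert m τ w w∈m = cong (relFace Ψ) (supp-∪-insert m τ w w∈m)

  outside-star : ∀ {i τ m} → inStar Ψ τ m ≡ false → ¬ (hasDeg i τ × inStar Ψ τ m ≡ true)
  outside-star out (_ , inside) with () ← trans (sym out) inside

  restrict : P.X → C.X
  restrict x τ = twist ∣ τ ∣ * x τ 𝟘

  extend : C.X → P.X
  extend z τ m with view m
  ... | constant _      = twist ∣ τ ∣ * z τ
  ... | divisibleBy _ _ = 0#

  contraction : P.X → P.X
  contraction x τ m with view m
  ... | constant _      = 0#
  ... | divisibleBy w _ = coneOp w (λ ρ → x ρ m) τ

  extend-𝟘 : ∀ z τ → extend z τ 𝟘 ≡ twist ∣ τ ∣ * z τ
  extend-𝟘 z τ with view (𝟘 {n})
  ... | constant _        = refl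
  ... | divisibleBy w w∈𝟘 = ⊥-elim (𝟘-has-no-variable w w∈𝟘)

  restrict-chain : ∀ x τ → C.d (restrict x) τ ≈ restrict (P.d x) τ
  restrict-chain x τ = begin
    C.d (restrict x) τ
      ≈⟨ ≈-sym (twist-coboundary (relFace Ψ) (λ ρ → x ρ 𝟘) τ) ⟩
    twist ∣ τ ∣ * coboundary (relFace Ψ) partSign (λ ρ → x ρ 𝟘) τ
      ≡⟨ cong (λ β → twist ∣ τ ∣ * [ β ] (sumFin (facetTerm partSign (λ ρ → x ρ 𝟘) τ))) (sym (inStar-𝟘 τ)) ⟩
    restrict (P.d x) τ ∎

  extend-chain : ∀ z τ m → P.d (extend z) τ m ≈ extend (C.d z) τ m
  extend-chain z τ m with view m
  ... | divisibleBy _ _ = coboundary-zero (λ σ → inStar Ψ σ m) partSign (λ _ → ≈-refl) τ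
  ... | constant refl   = begin
    coboundary (λ σ → inStar Ψ σ 𝟘) partSign (λ ρ → twist ∣ ρ ∣ * z ρ) τ
      ≡⟨ cong (λ β → [ β ] (sumFin (facetTerm partSign (λ ρ → twist ∣ ρ ∣ * z ρ) τ))) (inStar-𝟘 τ) ⟩
    coboundary (relFace Ψ) partSign (λ ρ → twist ∣ ρ ∣ * z ρ) τ
      ≈⟨ untwist-coboundary (relFace Ψ) z τ ⟩
    twist ∣ τ ∣ * C.d z τ ∎

  restrict-extend : ∀ z τ → restrict (extend z) τ ≈ z τ
  restrict-extend z τ = begin
    twist ∣ τ ∣ * extend z τ 𝟘          ≡⟨ cong (twist ∣ τ ∣ *_) (extend-𝟘 z τ) ⟩
    twist ∣ τ ∣ * (twist ∣ τ ∣ * z τ)    ≈⟨ sign-cancel (z τ) (twist-sign ∣ τ ∣) ⟩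
    z τ                                  ∎

  extend-cong : ∀ {z z′} → (∀ τ → z τ ≈ z′ τ) → ∀ τ m → extend z τ m ≈ extend z′ τ m
  extend-cong z≈z′ τ m with view m
  ... | constant _      = *-congˡ (z≈z′ τ)
  ... | divisibleBy _ _ = ≈-refl

  extend-vanishes : ∀ {z} → (∀ τ → z τ ≈ 0#) → ∀ τ m → extend z τ m ≈ 0#
  extend-vanishes z≈0 τ m with view m
  ... | constant _      = ≈-trans (*-congˡ (z≈0 τ)) (zeroʳ _)
  ... | divisibleBy _ _ = ≈-refl

  -- Every cocycle of P is cohomologous to its constant-monomial part: on a
  -- monomial divisible by x_w the stars form a cone with apex w.
  cocycle-decomposition : ∀ i {x} → P.Cocycle i x → ∀ τ m →
                          x τ m ≈ extend (restrict x) τ m + P.d (contraction x) τ m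
  cocycle-decomposition i {x} ((_ , supported) , closed) τ m with view m
  ... | constant refl = begin
    x τ 𝟘                                     ≈⟨ ≈-sym (sign-cancel (x τ 𝟘) (twist-sign ∣ τ ∣)) ⟩
    twist ∣ τ ∣ * restrict x τ                ≈⟨ ≈-sym (+-identityʳ _) ⟩
    twist ∣ τ ∣ * restrict x τ + 0#           ≈⟨ +-congˡ (≈-sym (coboundary-zero (λ σ → inStar Ψ σ 𝟘) partSign
                                                                               (λ _ → ≈-refl) τ)) ⟩
    twist ∣ τ ∣ * restrict x τ + coboundary (λ σ → inStar Ψ σ 𝟘) partSign (λ _ → 0#) τ ∎
  ... | divisibleBy w w∈m = begin
    x τ m                                     ≈⟨ cone-acyclic w (λ ρ → x ρ m) (λ σ → inStar Ψ σ m)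
                                                   (λ σ → inStar-insert m σ w w∈m)
                                                   (λ σ out → supported σ m (outside-star {i} out))
                                                   (λ σ → closed σ m) τ ⟩
    coboundary (λ σ → inStar Ψ σ m) partSign (coneOp w (λ ρ → x ρ m)) τ
                                              ≈⟨ ≈-sym (+-identityˡ _) ⟩
    0# + coboundary (λ σ → inStar Ψ σ m) partSign (coneOp w (λ ρ → x ρ m)) τ ∎

  restrict-deg : ∀ i {x} → P.Deg i x → C.Deg i (restrict x)
  restrict-deg i {x} (_ , supported) τ off = ≈-trans (*-congˡ (supported τ 𝟘 off′)) (zeroʳ _)
    where
    off′ : ¬ (hasDeg i τ × inStar Ψ τ 𝟘 ≡ true)
    off′ (deg , inside) = off (deg , trans (sym (inStar-𝟘 τ)) inside)

  extend-deg : ∀ i {z} → C.Deg i z → P.Deg i (extend z)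
  extend-deg i {z} supported = (0 , bounded) , supported′
    where
    bounded : ∀ τ m → (∃ λ v → 0 ℕ.< lookup m v) → extend z τ m ≈ 0#
    bounded τ m (v , 0<mv) with view m
    ... | constant refl   = ⊥-elim (𝟘-below-every-bound 0 v 0<mv)
    ... | divisibleBy _ _ = ≈-refl
    supported′ : ∀ τ m → ¬ (hasDeg i τ × inStar Ψ τ m ≡ true) → extend z τ m ≈ 0#
    supported′ τ m off with view m
    ... | divisibleBy _ _ = ≈-refl
    ... | constant refl   = ≈-trans (*-congˡ (supported τ off′)) (zeroʳ _)
      where
      off′ : ¬ (hasDeg i τ × relFace Ψ τ ≡ true)
      off′ (deg , inside) = off (deg , trans (inStar-𝟘 τ) inside)

  contraction-deg : ∀ i {x} → P.Deg i x → P.Deg (i ℤ.- ℤ.1ℤ) (contraction x)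
  contraction-deg i {x} ((B , bounded) , supported) = (B , bounded′) , supported′
    where
    bounded′ : ∀ τ m → (∃ λ v → B ℕ.< lookup m v) → contraction x τ m ≈ 0#
    bounded′ τ m big with view m
    ... | constant _      = ≈-refl
    ... | divisibleBy w _ = coneOp-vanishes w (λ ρ → x ρ m) τ (λ _ → bounded (insert τ w) m big)
    supported′ : ∀ τ m → ¬ (hasDeg (i ℤ.- ℤ.1ℤ) τ × inStar Ψ τ m ≡ true) → contraction x τ m ≈ 0#
    supported′ τ m off with view m
    ... | constant _        = ≈-refl
    ... | divisibleBy w w∈m = coneOp-vanishes w (λ ρ → x ρ m) τ (λ w∉τ → supported (insert τ w) m (off′ w∉τ))
      where
      off′ : lookup τ w ≡ false → ¬ (hasDeg i (insert τ w) × inStar Ψ (insert τ w) m ≡ true)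
      off′ w∉τ (deg , inside) =
        off ( degree-facet ∣ τ ∣ i (trans (cong ℤ.+_ (sym (size-insert τ w w∉τ))) deg)
            , trans (sym (inStar-insert m τ w w∈m)) inside )

  deg-combine : ∀ i {x y} z → P.Deg i x → P.Deg i y →
                (∀ τ m → x τ m ≈ 0# → y τ m ≈ 0# → z τ m ≈ 0#) → P.Deg i z
  deg-combine i z ((Bx , bx) , sx) ((By , by) , sy) combine =
    (Bx ℕ.⊔ By , bounded) , λ τ m off → combine τ m (sx τ m off) (sy τ m off)
    where
    bounded : ∀ τ m → (∃ λ v → Bx ℕ.⊔ By ℕ.< lookup m v) → z τ m ≈ 0#
    bounded τ m (v , big) = combine τ m (bx τ m (v , ≤-<-trans (m≤m⊔n Bx By) big))
                                        (by τ m (v , ≤-<-trans (m≤n⊔m Bx By) big))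

  cocycle-difference : ∀ i {x y} → P.Cocycle i x → P.Cocycle i y → P.Cocycle i (x P.⊖ y)
  cocycle-difference i {x} {y} (deg-x , closed-x) (deg-y , closed-y) =
    deg-combine i (x P.⊖ y) deg-x deg-y (λ τ m x≈0 y≈0 → difference-vanishes x≈0 y≈0) ,
    λ τ m → ≈-trans (coboundary-- (λ σ → inStar Ψ σ m) partSign (λ ρ → x ρ m) (λ ρ → y ρ m) τ)
                    (difference-vanishes (closed-x τ m) (closed-y τ m))
    where
    difference-vanishes : ∀ {a b} → a ≈ 0# → b ≈ 0# → a - b ≈ 0#
    difference-vanishes a≈0 b≈0 = ≈-trans (+-cong a≈0 (-‿cong b≈0)) (-‿inverseʳ 0#)

  -- d 0 = 0: the zero cochain witnesses that equal classes are cohomologous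
  C-d-𝟎 : ∀ τ → C.d C.𝟎 τ ≈ 0#
  C-d-𝟎 = coboundary-zero (relFace Ψ) simplicialSign (λ _ → ≈-refl)

  restrict-cocycle : ∀ i {x} → P.Cocycle i x → C.Cocycle i (restrict x)
  restrict-cocycle i {x} (deg , closed) =
    restrict-deg i deg , λ τ → ≈-trans (restrict-chain x τ) (≈-trans (*-congˡ (closed τ 𝟘)) (zeroʳ _))

  restrict-cohomologous : ∀ i {x y} → P.CohomEq i x y → C.CohomEq i (restrict x) (restrict y)
  restrict-cohomologous i {x} {y} (h , deg , x-y≈dh) = restrict h , restrict-deg (i ℤ.- ℤ.1ℤ) deg , λ τ → begin
    twist ∣ τ ∣ * x τ 𝟘 - twist ∣ τ ∣ * y τ 𝟘   ≈⟨ ≈-sym (x[y-z]≈xy-xz _ _ _) ⟩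
    twist ∣ τ ∣ * (x τ 𝟘 - y τ 𝟘)              ≈⟨ *-congˡ (x-y≈dh τ 𝟘) ⟩
    restrict (P.d h) τ                         ≈⟨ ≈-sym (restrict-chain h τ) ⟩
    C.d (restrict h) τ                         ∎

  restrict-linear : ∀ i a x y → C.CohomEq i (restrict ((a P.⊛ x) P.⊕ y)) ((a C.⊛ restrict x) C.⊕ restrict y)
  restrict-linear i a x y = C.𝟎 , (λ _ _ → ≈-refl) , λ τ → begin
    restrict ((a P.⊛ x) P.⊕ y) τ - (a * restrict x τ + restrict y τ)  ≈⟨ +-congʳ (linear τ) ⟩
    (a * restrict x τ + restrict y τ) - (a * restrict x τ + restrict y τ) ≈⟨ -‿inverseʳ _ ⟩
    0#                                                                 ≈⟨ ≈-sym (C-d-𝟎 τ) ⟩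
    C.d C.𝟎 τ                                                          ∎
    where
    linear : ∀ τ → restrict ((a P.⊛ x) P.⊕ y) τ ≈ a * restrict x τ + restrict y τ
    linear τ = ≈-trans (distribˡ (twist ∣ τ ∣) _ _) (+-congʳ (x∙yz≈y∙xz (twist ∣ τ ∣) a (x τ 𝟘)))

  restrict-injective : ∀ i {x y} → P.Cocycle i x → P.Cocycle i y →
                       C.CohomEq i (restrict x) (restrict y) → P.CohomEq i x y
  restrict-injective i {x} {y} cocycle-x cocycle-y (ψ , deg-ψ , restrict-x-y≈dψ) = h , deg-h , x-y≈dh
    where
    u : P.X
    u = x P.⊖ y
    cocycle-u : P.Cocycle i u
    cocycle-u = cocycle-difference i cocycle-x cocycle-y
    h : P.X
    h = extend ψ P.⊕ contraction u
    deg-h : P.Deg (i ℤ.- ℤ.1ℤ) h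
    deg-h = deg-combine (i ℤ.- ℤ.1ℤ) h (extend-deg (i ℤ.- ℤ.1ℤ) deg-ψ) (contraction-deg i (proj₁ cocycle-u))
                        (λ τ m a≈0 b≈0 → ≈-trans (+-cong a≈0 b≈0) (+-identityʳ 0#))
    restrict-u≈dψ : ∀ τ → restrict u τ ≈ C.d ψ τ
    restrict-u≈dψ τ = ≈-trans (x[y-z]≈xy-xz _ _ _) (restrict-x-y≈dψ τ)
    x-y≈dh : ∀ τ m → u τ m ≈ P.d h τ m
    x-y≈dh τ m = begin
      u τ m                                                ≈⟨ cocycle-decomposition i cocycle-u τ m ⟩
      extend (restrict u) τ m + P.d (contraction u) τ m    ≈⟨ +-congʳ (extend-cong restrict-u≈dψ τ m) ⟩
      extend (C.d ψ) τ m + P.d (contraction u) τ m         ≈⟨ +-congʳ (≈-sym (extend-chain ψ τ m)) ⟩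
      P.d (extend ψ) τ m + P.d (contraction u) τ m         ≈⟨ ≈-sym (coboundary-+ (λ σ → inStar Ψ σ m) partSign
                                                                        (λ ρ → extend ψ ρ m) (λ ρ → contraction u ρ m) τ) ⟩
      P.d h τ m                                            ∎

  restrict-surjective : ∀ i z → C.Cocycle i z →
                        Σ P.X (λ x → Σ (P.Cocycle i x) (λ _ → C.CohomEq i (restrict x) z))
  restrict-surjective i z (deg-z , closed-z) =
    extend z ,
    (extend-deg i deg-z , λ τ m → ≈-trans (extend-chain z τ m) (extend-vanishes closed-z τ m)) ,
    C.𝟎 , (λ _ _ → ≈-refl) ,
    λ τ → ≈-trans (+-congʳ (restrict-extend z τ)) (≈-trans (-‿inverseʳ (z τ)) (≈-sym (C-d-𝟎 τ)))

mainTheorem3 : ∀ {c ℓ : Level} (K : Field c ℓ) (n : ℕ) (Ψ : RelativeComplex n) (i : ℤ) →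
    let open OverField K in
    partitionComplex Ψ ≅H[ i ] simplicialComplex Ψ
mainTheorem3 K n Ψ i = record
  { Φ            = λ x _ → restrict x
  ; Φ-cocycle    = λ _ → restrict-cocycle i
  ; Φ-wd         = λ _ _ _ _ → restrict-cohomologous i
  ; Φ-linear     = λ a x _ y _ _ → restrict-linear i a x y
  ; Φ-injective  = λ _ cocycle-x _ cocycle-y → restrict-injective i cocycle-x cocycle-y
  ; Φ-surjective = restrict-surjective i
  }
  where open Comparison K Ψ
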